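{- Let $n>2$ be an integer and let $u$ be a vertex of the complete graph $K_n$ on $n$ vertices. The number $c_n$ of cycles through $u$ in $K_n$ is $$c_n=\lfloor e\,(n-1)!\rfloor-n,$$ and the sum $L_c(n)$ of the lengths of all these cycles is $$L_c(n)=\lfloor e\, n!\rfloor-\lfloor e\,(n-1)!\rfloor-2n+1 .$$
   Context: A cycle through $u$ of length $i$ (with $3\le i\le n$) is a sequence $(u,x_1,\dots,x_{i-1},u)$ where $x_1,\dots,x_{i-1}$ are pairwise distinct vertices different from $u$; distinct sequences are counted as distinct cycles (so a cycle traversed in the two directions is counted twice). $\lfloor x\rfloor$ denotes the floor of $x$. -}

module Defs where

open import Data.Nat using (ℕ; zero; suc; _+_; _*_; _∸_; _!)
open import Data.Nat.Properties using (_!≢0)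
open import Data.Integer using (+_)
open import Data.Rational using (ℚ; 0ℚ; _/_) renaming (_+_ to _+ℚ_; _*_ to _*ℚ_; _<_ to _<ℚ_; _≤_ to _≤ℚ_)
open import Data.Fin using (Fin)
open import Data.Fin.Properties using (_≟_)
open import Data.Vec using (Vec; []; _∷_; toList)
open import Data.List using (List; [_]; map; concatMap; allFin; filter; length; applyUpTo)
open import Data.Nat.ListAction using (sum)
open import Data.List.Relation.Unary.All using (All; all?)
open import Data.List.Relation.Unary.Unique.Propositional using (Unique)
open import Data.List.Relation.Unary.Unique.DecPropositional using (unique?)
open import Data.Product using (_×_; Σ; ∃)
open import Relation.Binary.PropositionalEquality using (_≢_)
open import Relation.Nullary using (Dec; ¬?)
open import Relation.Nullary.Decidable using (_×-dec_)

invFact : ℕ → ℚ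
invFact j = (+ 1 / (j !)) {{j !≢0}}

S : ℕ → ℚ
S zero    = invFact 0
S (suc k) = S k +ℚ invFact (suc k)

-- e·m! is the supremum of the increasing sequence  m! · S k.
-- IsFloorE m N  :⇔  N = ⌊ e · m! ⌋, i.e.  N ≤ e·m! < N+1, where
--   N ≤ sup_k a_k    ⇔  every rational q < N is exceeded by some a_k
--   sup_k a_k < N+1  ⇔  some rational q < N+1 bounds all a_k
efact : ℕ → ℕ → ℚ
efact m k = (+ (m !) / 1) *ℚ S k

IsFloorE : ℕ → ℕ → Set
IsFloorE m N =
  ((q : ℚ) → q <ℚ (+ N / 1) → ∃ λ k → q <ℚ efact m k)
  × (Σ ℚ λ q → (q <ℚ (+ (suc N) / 1)) × ((k : ℕ) → efact m k ≤ℚ q))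

-- Cycles through u in K_n (vertices Fin n; any two distinct vertices adjacent).
-- A cycle of length i is (u, x_1, …, x_{i-1}, u) with x_1..x_{i-1} pairwise
-- distinct and different from u; it is determined by the vector (x_1,…,x_{i-1}).

allVecs : (n k : ℕ) → List (Vec (Fin n) k)
allVecs n zero    = [ [] ]
allVecs n (suc k) = concatMap (λ v → map (_∷ v) (allFin n)) (allVecs n k)

IsCycleBody : ∀ {n k} → Fin n → Vec (Fin n) k → Set
IsCycleBody u xs = All (λ x → x ≢ u) (toList xs) × Unique (toList xs)

isCycleBody? : ∀ {n k} (u : Fin n) (xs : Vec (Fin n) k) → Dec (IsCycleBody u xs)
isCycleBody? u xs = all? (λ x → ¬? (x ≟ u)) (toList xs) ×-dec unique? _≟_ (toList xs)

cyclesOfLength : (n : ℕ) → Fin n → ℕ → ℕ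
cyclesOfLength n u i = length (filter (isCycleBody? u) (allVecs n (i ∸ 1)))

lengths : ℕ → List ℕ
lengths n = applyUpTo (λ j → 3 + j) (n ∸ 2)

cycleCount : (n : ℕ) → Fin n → ℕ
cycleCount n u = sum (map (cyclesOfLength n u) (lengths n))

cycleLengthSum : (n : ℕ) → Fin n → ℕ
cycleLengthSum n u = sum (map (λ i → i * cyclesOfLength n u i) (lengths n))

{-# OPTIONS --safe #-}

-- A cycle through u of length i is determined by an injective sequence of i − 1 of the
-- other m = n − 1 vertices, so there are m ↓ (i − 1) of them (falling factorial).  Hence
-- both c_n and L_c(n) are sums of falling factorials of m, which we compare with the
-- number of arrangements a(m) = Σ_{k ≤ m} m ↓ k = Σ_{j ≤ m} m!/j!: directly for c_n, and
-- for L_c(n) through the telescoping identity m · m ↓ k = k · m ↓ k + m ↓ (k + 1), which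
-- gives Σ_{k ≤ m} (k + 1) · m ↓ k = m · a(m) + 1.
--
-- Finally a(m) = ⌊e · m!⌋ for m ≥ 2: the partial sums m! · S k equal m! · a(k) / k!; they
-- reach a(m) at k = m, increase up to k = m, and beyond it stay below a(m) + 1/m < a(m) + 1
-- because the remaining terms are dominated by a geometric series with ratio 1/(m + 1).

module Submission where

open import Defs
open import Data.Integer as ℤ using (+_; +≤+; +<+)
import Data.Integer.Properties as ℤ
open import Data.Fin using (Fin)
open import Data.Fin.Properties using (_≟_)
open import Data.List using (List; []; _∷_; map; concatMap; allFin; filter; length; applyUpTo; _++_)
open import Data.List.Properties using (filter-++; length-++; filter-≐; filter-none; length-tabulate)
open import Data.List.Membership.Propositional using (_∈_; _∉_)
open import Data.List.Membership.Propositional.Properties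
  using (∈-filter⁻; ∈-filter⁺; ∈-allFin; ∈-++⁺ˡ; ∈-++⁺ʳ)
open import Data.List.Membership.Propositional.Properties.WithK using (unique∧set⇒bag)
import Data.List.Membership.DecPropositional as DecMembership
open import Data.List.Relation.Binary.BagAndSetEquality using (_∼[_]_; set; ∼bag⇒↭)
open import Data.List.Relation.Binary.Permutation.Propositional.Properties using (↭-length)
open import Data.List.Relation.Unary.All as All using (_∷_)
open import Data.List.Relation.Unary.All.Properties using (¬Any⇒All¬; All¬⇒¬Any)
open import Data.List.Relation.Unary.AllPairs using (_∷_)
open import Data.List.Relation.Unary.Unique.Propositional using (Unique)
open import Data.List.Relation.Unary.Unique.Propositional.Properties using (++⁺; filter⁺; allFin⁺)
open import Data.Nat
  using (ℕ; zero; suc; _+_; _*_; _∸_; _≤_; _<_; _!; NonZero; >-nonZero; s≤s; z≤n)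
open import Data.Nat.ListAction using (sum)
open import Data.Nat.Properties
  using ( _!≢0; +-comm; +-assoc; +-identityʳ; *-comm; *-assoc; *-zeroʳ; *-identityˡ; *-identityʳ
        ; *-distribˡ-+; *-commutativeSemigroup; ≤-refl; ≤-reflexive; ≤-trans; ≤-total
        ; m≤m+n; m≤n+m; m≤n⇒m≤1+n; m∸n+n≡m; m+n∸n≡m
        ; +-monoʳ-≤; +-monoˡ-<; *-monoʳ-≤; *-monoˡ-≤
        ; module ≤-Reasoning )
open import Data.Nat.Tactic.RingSolver using (solve-∀)
open import Algebra.Properties.CommutativeSemigroup *-commutativeSemigroup
  using (x∙yz≈y∙xz; xy∙z≈z∙yx; xy∙z≈zx∙y)
open import Data.Product using (_×_; _,_; proj₂)
open import Data.Rational using (_/_; toℚᵘ)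
  renaming (_+_ to _+ℚ_; _*_ to _*ℚ_; _≤_ to _≤ℚ_; _<_ to _<ℚ_)
import Data.Rational.Properties as ℚ
open import Data.Rational.Unnormalised as ℚᵘ
  using (*≡*; *≤*; *<*; _≃_) renaming (_/_ to _/ᵘ_)
open import Data.Rational.Unnormalised.Properties
  using (≃-trans; ≃-sym; ≤-respˡ-≃; ≤-respʳ-≃; <-respˡ-≃; <-respʳ-≃; +-cong; *-cong)
open import Data.Sum using (inj₁; inj₂)
open import Data.Vec using (Vec; _∷_; toList)
open import Data.Vec.Properties using (length-toList)
open import Function using (_∘_; mk⇔)
open import Level using (Level)
open import Relation.Binary.PropositionalEquality
open import Relation.Nullary using (¬_; ¬?; yes; no)
open import Relation.Unary using (Pred; Decidable; _≐_)

private variable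
  ℓ₁ ℓ₂ : Level
  A B : Set ℓ₁

module _ {P : Pred A ℓ₂} (P? : Decidable P) where

  length-filter-concatMap : (f : B → List A) (xs : List B) →
    length (filter P? (concatMap f xs)) ≡ sum (map (length ∘ filter P? ∘ f) xs)
  length-filter-concatMap f []       = refl
  length-filter-concatMap f (x ∷ xs) = begin
    length (filter P? (f x ++ concatMap f xs))              ≡⟨ cong length (filter-++ P? (f x) _) ⟩
    length (filter P? (f x) ++ filter P? (concatMap f xs))  ≡⟨ length-++ (filter P? (f x)) ⟩
    length (filter P? (f x)) + length (filter P? (concatMap f xs))
      ≡⟨ cong (_+_ (length (filter P? (f x)))) (length-filter-concatMap f xs) ⟩
    sum (map (length ∘ filter P? ∘ f) (x ∷ xs))             ∎
    where open ≡-Reasoning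

  length-filter-map : (g : B → A) (xs : List B) →
    length (filter P? (map g xs)) ≡ length (filter (P? ∘ g) xs)
  length-filter-map g []       = refl
  length-filter-map g (x ∷ xs) with P? (g x)
  ... | yes _ = cong suc (length-filter-map g xs)
  ... | no  _ = length-filter-map g xs

  sum-map-indicator : ∀ {g : A → ℕ} {c} (xs : List A) →
    (∀ {x} → P x → g x ≡ c) → (∀ {x} → ¬ P x → g x ≡ 0) →
    sum (map g xs) ≡ length (filter P? xs) * c
  sum-map-indicator []       _  _   = refl
  sum-map-indicator (x ∷ xs) on off with P? x
  ... | yes px  = cong₂ _+_ (on px) (sum-map-indicator xs on off)
  ... | no  ¬px = cong₂ _+_ (off ¬px) (sum-map-indicator xs on off)

module _ {n : ℕ} where
  open DecMembership (_≟_ {n}) using (_∈?_)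

  length-filter-∉ : (ws : List (Fin n)) → Unique ws →
    length (filter (λ x → ¬? (x ∈? ws)) (allFin n)) + length ws ≡ n
  length-filter-∉ ws ws! = begin
    length fresh + length ws  ≡⟨ length-++ fresh ⟨
    length (fresh ++ ws)
      ≡⟨ ↭-length (∼bag⇒↭ (unique∧set⇒bag fresh++ws! (allFin⁺ n) fresh++ws≈allFin)) ⟩
    length (allFin n)         ≡⟨ length-tabulate {n = n} (λ i → i) ⟩
    n                         ∎
    where
    open ≡-Reasoning
    fresh? = λ x → ¬? (x ∈? ws)
    fresh = filter fresh? (allFin n)
    fresh++ws! : Unique (fresh ++ ws)
    fresh++ws! = ++⁺ (filter⁺ fresh? (allFin⁺ n)) ws!
      (λ (x∈fresh , x∈ws) → proj₂ (∈-filter⁻ fresh? {xs = allFin n} x∈fresh) x∈ws)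
    fresh++ws≈allFin : (fresh ++ ws) ∼[ set ] allFin n
    fresh++ws≈allFin {x} = mk⇔ (λ _ → ∈-allFin x) (λ _ → fresh-or-ws (x ∈? ws))
      where
      fresh-or-ws : _ → x ∈ fresh ++ ws
      fresh-or-ws (yes x∈ws) = ∈-++⁺ʳ fresh x∈ws
      fresh-or-ws (no  x∉ws) = ∈-++⁺ˡ (∈-filter⁺ fresh? (∈-allFin x) x∉ws)

infix 8 _↓_

_↓_ : ℕ → ℕ → ℕ
m     ↓ zero  = 1
zero  ↓ suc k = 0
suc m ↓ suc k = suc m * m ↓ k

↓-suc : ∀ m k → m ↓ suc k ≡ m ↓ k * (m ∸ k)
↓-suc zero    zero    = refl
↓-suc zero    (suc k) = refl
↓-suc (suc m) zero    = trans (*-identityʳ (suc m)) (sym (*-identityˡ (suc m)))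
↓-suc (suc m) (suc k) = trans (cong (suc m *_) (↓-suc m k)) (sym (*-assoc (suc m) (m ↓ k) (m ∸ k)))

m↓[1+m]≡0 : ∀ m → m ↓ suc m ≡ 0
m↓[1+m]≡0 zero    = refl
m↓[1+m]≡0 (suc m) = trans (cong (suc m *_) (m↓[1+m]≡0 m)) (*-zeroʳ (suc m))

m*m↓k≡k*m↓k+m↓[1+k] : ∀ m k → m * m ↓ k ≡ k * m ↓ k + m ↓ suc k
m*m↓k≡k*m↓k+m↓[1+k] zero    zero    = refl
m*m↓k≡k*m↓k+m↓[1+k] zero    (suc k) = sym (trans (+-identityʳ (suc k * 0)) (*-zeroʳ (suc k)))
m*m↓k≡k*m↓k+m↓[1+k] (suc m) zero    = refl
m*m↓k≡k*m↓k+m↓[1+k] (suc m) (suc k) = begin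
  suc m * (m ↓ k + m * m ↓ k)
    ≡⟨ cong (λ y → suc m * (m ↓ k + y)) (m*m↓k≡k*m↓k+m↓[1+k] m k) ⟩
  suc m * (m ↓ k + (k * m ↓ k + m ↓ suc k))
    ≡⟨ rearrange (suc m) (m ↓ k) k (m ↓ suc k) ⟩
  suc k * (suc m * m ↓ k) + suc m * m ↓ suc k ∎
  where
  open ≡-Reasoning
  rearrange : ∀ s x k y → s * (x + (k * x + y)) ≡ (1 + k) * (s * x) + s * y
  rearrange = solve-∀

module _ {m : ℕ} (u : Fin (suc m)) where
  open DecMembership (_≟_ {suc m}) using (_∈?_)

  ∷-isCycleBody : ∀ {k} {v : Vec (Fin (suc m)) k} → IsCycleBody u v →
    (λ x → IsCycleBody u (x ∷ v)) ≐ (λ x → x ∉ u ∷ toList v)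
  ∷-isCycleBody {v = v} (v≢u , v!) = extension⇒fresh , fresh⇒extension
    where
    extension⇒fresh : ∀ {x} → IsCycleBody u (x ∷ v) → x ∉ u ∷ toList v
    extension⇒fresh ((x≢u ∷ _) , (x∉v ∷ _)) = All¬⇒¬Any (x≢u ∷ x∉v)
    fresh⇒extension : ∀ {x} → x ∉ u ∷ toList v → IsCycleBody u (x ∷ v)
    fresh⇒extension x∉ with ¬Any⇒All¬ _ x∉
    ... | x≢u ∷ x∉v = (x≢u ∷ v≢u) , (x∉v ∷ v!)

  cycleBody-extensions : ∀ {k} {v : Vec (Fin (suc m)) k} → IsCycleBody u v →
    length (filter (isCycleBody? u) (map (_∷ v) (allFin (suc m)))) ≡ m ∸ k
  cycleBody-extensions {k} {v} body@(v≢u , v!) = begin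
    length (filter (isCycleBody? u) (map (_∷ v) (allFin (suc m))))
      ≡⟨ length-filter-map (isCycleBody? u) (_∷ v) (allFin (suc m)) ⟩
    length (filter (λ x → isCycleBody? u (x ∷ v)) (allFin (suc m)))
      ≡⟨ cong length (filter-≐ (isCycleBody? u ∘ (_∷ v)) fresh? (∷-isCycleBody body) (allFin (suc m))) ⟩
    fresh                      ≡⟨ m+n∸n≡m fresh (suc k) ⟨
    fresh + suc k ∸ suc k      ≡⟨ cong (λ l → fresh + suc l ∸ suc k) (length-toList v) ⟨
    fresh + length ws ∸ suc k
      ≡⟨ cong (_∸ suc k) (length-filter-∉ ws (All.map ≢-sym v≢u ∷ v!)) ⟩
    suc m ∸ suc k              ∎
    where
    open ≡-Reasoning
    ws = u ∷ toList v
    fresh? = λ x → ¬? (x ∈? ws)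
    fresh = length (filter fresh? (allFin (suc m)))

  ¬cycleBody-extensions : ∀ {k} {v : Vec (Fin (suc m)) k} → ¬ IsCycleBody u v →
    length (filter (isCycleBody? u) (map (_∷ v) (allFin (suc m)))) ≡ 0
  ¬cycleBody-extensions {v = v} ¬body =
    trans (length-filter-map (isCycleBody? u) (_∷ v) (allFin (suc m)))
          (cong length (filter-none (λ x → isCycleBody? u (x ∷ v)) {xs = allFin (suc m)}
            (All.tabulate λ { _ ((_ ∷ v≢u) , (_ ∷ v!)) → ¬body (v≢u , v!) })))

  length-cycleBodies : ∀ k → length (filter (isCycleBody? u) (allVecs (suc m) k)) ≡ m ↓ k
  length-cycleBodies zero    = refl
  length-cycleBodies (suc k) = begin
    length (filter (isCycleBody? u) (concatMap extensions vs))
      ≡⟨ length-filter-concatMap (isCycleBody? u) extensions vs ⟩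
    sum (map (length ∘ filter (isCycleBody? u) ∘ extensions) vs)
      ≡⟨ sum-map-indicator (isCycleBody? u) vs cycleBody-extensions ¬cycleBody-extensions ⟩
    length (filter (isCycleBody? u) vs) * (m ∸ k)
      ≡⟨ cong (_* (m ∸ k)) (length-cycleBodies k) ⟩
    m ↓ k * (m ∸ k)  ≡⟨ ↓-suc m k ⟨
    m ↓ suc k        ∎
    where
    open ≡-Reasoning
    vs = allVecs (suc m) k
    extensions : Vec (Fin (suc m)) k → List (Vec (Fin (suc m)) (suc k))
    extensions v = map (_∷ v) (allFin (suc m))

infix 5 ∑

∑ : ℕ → (ℕ → ℕ) → ℕ
∑ zero    f = 0
∑ (suc c) f = f 0 + ∑ c (f ∘ suc)

syntax ∑ c (λ k → e) = ∑[ k < c ] e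

∑-cong : ∀ c {f g : ℕ → ℕ} → (∀ k → f k ≡ g k) → ∑ c f ≡ ∑ c g
∑-cong zero    f≗g = refl
∑-cong (suc c) f≗g = cong₂ _+_ (f≗g 0) (∑-cong c (f≗g ∘ suc))

∑-init-last : ∀ c f → ∑ (suc c) f ≡ ∑ c f + f c
∑-init-last zero    f = +-comm (f 0) 0
∑-init-last (suc c) f = trans (cong (_+_ (f 0)) (∑-init-last c (f ∘ suc))) (sym (+-assoc (f 0) _ _))

*-distribˡ-∑ : ∀ x c f → x * ∑ c f ≡ ∑[ k < c ] x * f k
*-distribˡ-∑ x zero    f = *-zeroʳ x
*-distribˡ-∑ x (suc c) f =
  trans (*-distribˡ-+ x (f 0) _) (cong (_+_ (x * f 0)) (*-distribˡ-∑ x c (f ∘ suc)))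

sum-map-applyUpTo : ∀ (g f : ℕ → ℕ) c → sum (map g (applyUpTo f c)) ≡ ∑[ j < c ] g (f j)
sum-map-applyUpTo g f zero    = refl
sum-map-applyUpTo g f (suc c) = cong (_+_ (g (f 0))) (sum-map-applyUpTo g (f ∘ suc) c)

arrangements : ℕ → ℕ
arrangements zero    = 1
arrangements (suc m) = suc m * arrangements m + 1

arrangements≡∑↓ : ∀ m → arrangements m ≡ ∑[ k < suc m ] m ↓ k
arrangements≡∑↓ zero    = refl
arrangements≡∑↓ (suc m) = begin
  suc m * arrangements m + 1          ≡⟨ +-comm _ 1 ⟩
  1 + suc m * arrangements m          ≡⟨ cong (λ a → 1 + suc m * a) (arrangements≡∑↓ m) ⟩
  1 + suc m * (∑[ k < suc m ] m ↓ k)  ≡⟨ cong suc (*-distribˡ-∑ (suc m) (suc m) (m ↓_)) ⟩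
  ∑[ k < suc (suc m) ] suc m ↓ k      ∎
  where open ≡-Reasoning

∑-telescope : ∀ m c → (∑[ k < c ] suc k * m ↓ k) + m ↓ c ≡ m * (∑[ k < c ] m ↓ k) + 1
∑-telescope m zero    = cong (_+ 1) (sym (*-zeroʳ m))
∑-telescope m (suc c) = begin
  (∑[ k < suc c ] suc k * m ↓ k) + m ↓ suc c
    ≡⟨ cong (_+ m ↓ suc c) (∑-init-last c (λ k → suc k * m ↓ k)) ⟩
  (∑[ k < c ] suc k * m ↓ k) + suc c * m ↓ c + m ↓ suc c
    ≡⟨ regroup (∑[ k < c ] suc k * m ↓ k) c (m ↓ c) (m ↓ suc c) ⟩
  ((∑[ k < c ] suc k * m ↓ k) + m ↓ c) + (c * m ↓ c + m ↓ suc c)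
    ≡⟨ cong₂ _+_ (∑-telescope m c) (sym (m*m↓k≡k*m↓k+m↓[1+k] m c)) ⟩
  m * (∑[ k < c ] m ↓ k) + 1 + m * m ↓ c
    ≡⟨ collect m (∑[ k < c ] m ↓ k) (m ↓ c) ⟩
  m * ((∑[ k < c ] m ↓ k) + m ↓ c) + 1
    ≡⟨ cong (λ s → m * s + 1) (∑-init-last c (m ↓_)) ⟨
  m * (∑[ k < suc c ] m ↓ k) + 1
    ∎
  where
  open ≡-Reasoning
  regroup : ∀ s c x y → s + (1 + c) * x + y ≡ (s + x) + (c * x + y)
  regroup = solve-∀
  collect : ∀ m s x → m * s + 1 + m * x ≡ m * (s + x) + 1
  collect = solve-∀

∑[1+k]*m↓k≡m*arrangements+1 : ∀ m → (∑[ k < suc m ] suc k * m ↓ k) ≡ m * arrangements m + 1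
∑[1+k]*m↓k≡m*arrangements+1 m = begin
  s                               ≡⟨ +-identityʳ s ⟨
  s + 0                           ≡⟨ cong (_+_ s) (m↓[1+m]≡0 m) ⟨
  s + m ↓ suc m                   ≡⟨ ∑-telescope m (suc m) ⟩
  m * (∑[ k < suc m ] m ↓ k) + 1  ≡⟨ cong (λ a → m * a + 1) (arrangements≡∑↓ m) ⟨
  m * arrangements m + 1          ∎
  where
  open ≡-Reasoning
  s = ∑[ k < suc m ] suc k * m ↓ k

cycleCount≡∑ : ∀ m (u : Fin (suc m)) → cycleCount (suc m) u ≡ ∑[ j < m ∸ 1 ] m ↓ (2 + j)
cycleCount≡∑ m u = trans (sum-map-applyUpTo (cyclesOfLength (suc m) u) (_+_ 3) (m ∸ 1))
                         (∑-cong (m ∸ 1) (λ j → length-cycleBodies u (2 + j)))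

cycleLengthSum≡∑ : ∀ m (u : Fin (suc m)) →
  cycleLengthSum (suc m) u ≡ ∑[ j < m ∸ 1 ] (3 + j) * m ↓ (2 + j)
cycleLengthSum≡∑ m u =
  trans (sum-map-applyUpTo (λ i → i * cyclesOfLength (suc m) u i) (_+_ 3) (m ∸ 1))
        (∑-cong (m ∸ 1) (λ j → cong ((3 + j) *_) (length-cycleBodies u (2 + j))))

cycleCount+n≡arrangements : ∀ m (u : Fin (suc m)) → cycleCount (suc m) u + suc m ≡ arrangements m
cycleCount+n≡arrangements zero    u = refl
cycleCount+n≡arrangements (suc m) u = begin
  cycleCount (2 + m) u + (2 + m)  ≡⟨ cong (_+ (2 + m)) (cycleCount≡∑ (suc m) u) ⟩
  c + (2 + m)                     ≡⟨ shuffle c m ⟩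
  -- the sum ∑[ k < 2 + m ] (1 + m) ↓ k with its terms k = 0, 1 unfolded
  1 + ((1 + m) * 1 + c)           ≡⟨ arrangements≡∑↓ (suc m) ⟨
  arrangements (suc m)            ∎
  where
  open ≡-Reasoning
  c = ∑[ j < m ] suc m ↓ (2 + j)
  shuffle : ∀ c m → c + (2 + m) ≡ 1 + ((1 + m) * 1 + c)
  shuffle = solve-∀

cycleLengthSum+arrangements+2n∸1≡arrangements : ∀ m (u : Fin (suc m)) →
  cycleLengthSum (suc m) u + arrangements m + 2 * suc m ∸ 1 ≡ arrangements (suc m)
cycleLengthSum+arrangements+2n∸1≡arrangements zero    u = refl
cycleLengthSum+arrangements+2n∸1≡arrangements (suc m) u = cong (_∸ 1) (begin
  cycleLengthSum (2 + m) u + a + 2 * (2 + m)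
    ≡⟨ cong (λ l → l + a + 2 * (2 + m)) (cycleLengthSum≡∑ (suc m) u) ⟩
  l + a + 2 * (2 + m)
    ≡⟨ shuffle l a m ⟩
  -- the sum ∑[ k < 2 + m ] (1 + k) * (1 + m) ↓ k with its terms k = 0, 1 unfolded
  suc (1 * 1 + (2 * ((1 + m) * 1) + l) + a)
    ≡⟨ cong (λ s → suc (s + a)) (∑[1+k]*m↓k≡m*arrangements+1 (suc m)) ⟩
  suc ((1 + m) * a + 1 + a)
    ≡⟨ cong suc (collect a m) ⟩
  suc (arrangements (2 + m))
    ∎)
  where
  open ≡-Reasoning
  a = arrangements (suc m)
  l = ∑[ j < m ] (3 + j) * suc m ↓ (2 + j)
  shuffle : ∀ l a m → l + a + 2 * (2 + m) ≡ suc (1 * 1 + (2 * ((1 + m) * 1) + l) + a)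
  shuffle = solve-∀
  collect : ∀ a m → (1 + m) * a + 1 + a ≡ (2 + m) * a + 1
  collect = solve-∀

private
  toℚᵘ-/ : ∀ a b .{{_ : NonZero b}} → toℚᵘ (+ a / b) ≃ + a /ᵘ b
  toℚᵘ-/ a (suc b) = ℚ.toℚᵘ-fromℚᵘ (+ a /ᵘ suc b)

  /ᵘ-≃ : ∀ a b c d .{{_ : NonZero b}} .{{_ : NonZero d}} →
         a * d ≡ c * b → + a /ᵘ b ≃ + c /ᵘ d
  /ᵘ-≃ a (suc b) c (suc d) eq = *≡* (trans (sym (ℤ.pos-* a _)) (trans (cong +_ eq) (ℤ.pos-* c _)))

  /ᵘ-≤ : ∀ a b c d .{{_ : NonZero b}} .{{_ : NonZero d}} →
         a * d ≤ c * b → + a /ᵘ b ℚᵘ.≤ + c /ᵘ d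
  /ᵘ-≤ a (suc b) c (suc d) le = *≤* (subst₂ ℤ._≤_ (ℤ.pos-* a _) (ℤ.pos-* c _) (+≤+ le))

  /ᵘ-< : ∀ a b c d .{{_ : NonZero b}} .{{_ : NonZero d}} →
         a * d < c * b → + a /ᵘ b ℚᵘ.< + c /ᵘ d
  /ᵘ-< a (suc b) c (suc d) lt = *<* (subst₂ ℤ._<_ (ℤ.pos-* a _) (ℤ.pos-* c _) (+<+ lt))

  /ᵘ+/ᵘ : ∀ a b c d e f .{{_ : NonZero b}} .{{_ : NonZero d}} .{{_ : NonZero f}} →
          (a * d + c * b) * f ≡ e * (b * d) → (+ a /ᵘ b) ℚᵘ.+ (+ c /ᵘ d) ≃ + e /ᵘ f
  /ᵘ+/ᵘ a (suc b) c (suc d) e (suc f) eq = *≡* (begin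
    (+ a ℤ.* + suc d ℤ.+ + c ℤ.* + suc b) ℤ.* + suc f
      ≡⟨ cong (ℤ._* + suc f) (cong₂ ℤ._+_ (ℤ.pos-* a _) (ℤ.pos-* c _)) ⟨
    (+ (a * suc d) ℤ.+ + (c * suc b)) ℤ.* + suc f
      ≡⟨ cong (ℤ._* + suc f) (ℤ.pos-+ (a * suc d) _) ⟨
    + (a * suc d + c * suc b) ℤ.* + suc f  ≡⟨ ℤ.pos-* (a * suc d + c * suc b) (suc f) ⟨
    + ((a * suc d + c * suc b) * suc f)   ≡⟨ cong +_ eq ⟩
    + (e * (suc b * suc d))               ≡⟨ ℤ.pos-* e _ ⟩
    + e ℤ.* + (suc b * suc d)             ∎)
    where open ≡-Reasoning

  /ᵘ*/ᵘ : ∀ a b c d e f .{{_ : NonZero b}} .{{_ : NonZero d}} .{{_ : NonZero f}} →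
          a * c * f ≡ e * (b * d) → (+ a /ᵘ b) ℚᵘ.* (+ c /ᵘ d) ≃ + e /ᵘ f
  /ᵘ*/ᵘ a (suc b) c (suc d) e (suc f) eq = *≡* (begin
    + a ℤ.* + c ℤ.* + suc f    ≡⟨ cong (ℤ._* + suc f) (ℤ.pos-* a c) ⟨
    + (a * c) ℤ.* + suc f      ≡⟨ ℤ.pos-* (a * c) (suc f) ⟨
    + (a * c * suc f)          ≡⟨ cong +_ eq ⟩
    + (e * (suc b * suc d))    ≡⟨ ℤ.pos-* e _ ⟩
    + e ℤ.* + (suc b * suc d)  ∎)
    where open ≡-Reasoning

/-≡ : ∀ a b c d .{{_ : NonZero b}} .{{_ : NonZero d}} → a * d ≡ c * b → + a / b ≡ + c / d
/-≡ a b c d eq = ℚ.toℚᵘ-injective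
  (≃-trans (toℚᵘ-/ a b) (≃-trans (/ᵘ-≃ a b c d eq) (≃-sym (toℚᵘ-/ c d))))

/-≤ : ∀ a b c d .{{_ : NonZero b}} .{{_ : NonZero d}} → a * d ≤ c * b → + a / b ≤ℚ + c / d
/-≤ a b c d le = ℚ.toℚᵘ-cancel-≤
  (≤-respˡ-≃ (≃-sym (toℚᵘ-/ a b))
  (≤-respʳ-≃ (≃-sym (toℚᵘ-/ c d)) (/ᵘ-≤ a b c d le)))

/-< : ∀ a b c d .{{_ : NonZero b}} .{{_ : NonZero d}} → a * d < c * b → + a / b <ℚ + c / d
/-< a b c d lt = ℚ.toℚᵘ-cancel-<
  (<-respˡ-≃ (≃-sym (toℚᵘ-/ a b))
  (<-respʳ-≃ (≃-sym (toℚᵘ-/ c d)) (/ᵘ-< a b c d lt)))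

/+/ : ∀ a b c d e f .{{_ : NonZero b}} .{{_ : NonZero d}} .{{_ : NonZero f}} →
      (a * d + c * b) * f ≡ e * (b * d) → + a / b +ℚ + c / d ≡ + e / f
/+/ a b c d e f eq = ℚ.toℚᵘ-injective
  (≃-trans (ℚ.toℚᵘ-homo-+ (+ a / b) (+ c / d))
  (≃-trans (+-cong (toℚᵘ-/ a b) (toℚᵘ-/ c d))
  (≃-trans (/ᵘ+/ᵘ a b c d e f eq) (≃-sym (toℚᵘ-/ e f)))))

/*/ : ∀ a b c d e f .{{_ : NonZero b}} .{{_ : NonZero d}} .{{_ : NonZero f}} →
      a * c * f ≡ e * (b * d) → (+ a / b) *ℚ (+ c / d) ≡ + e / f
/*/ a b c d e f eq = ℚ.toℚᵘ-injective
  (≃-trans (ℚ.toℚᵘ-homo-* (+ a / b) (+ c / d))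
  (≃-trans (*-cong (toℚᵘ-/ a b) (toℚᵘ-/ c d))
  (≃-trans (/ᵘ*/ᵘ a b c d e f eq) (≃-sym (toℚᵘ-/ e f)))))

S≡arrangements/! : ∀ k → S k ≡ (+ arrangements k / k !) {{k !≢0}}
S≡arrangements/! zero    = refl
S≡arrangements/! (suc k) = begin
  S k +ℚ invFact (suc k)                   ≡⟨ cong (_+ℚ invFact (suc k)) (S≡arrangements/! k) ⟩
  + arrangements k / k ! +ℚ + 1 / suc k !
    ≡⟨ /+/ (arrangements k) (k !) 1 (suc k !) (arrangements (suc k)) (suc k !)
           (common-denominator (arrangements k) k (k !)) ⟩
  + arrangements (suc k) / suc k !         ∎
  where
  open ≡-Reasoning
  instance
    k!≢0 = k !≢0
    [1+k]!≢0 = suc k !≢0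
  common-denominator : ∀ a k f →
    (a * ((1 + k) * f) + 1 * f) * ((1 + k) * f) ≡ ((1 + k) * a + 1) * (f * ((1 + k) * f))
  common-denominator = solve-∀

efact≡m!*arrangements/! : ∀ m k → efact m k ≡ (+ (m ! * arrangements k) / k !) {{k !≢0}}
efact≡m!*arrangements/! m k = begin
  (+ (m !) / 1) *ℚ S k                       ≡⟨ cong ((+ (m !) / 1) *ℚ_) (S≡arrangements/! k) ⟩
  (+ (m !) / 1) *ℚ (+ arrangements k / k !)
    ≡⟨ /*/ (m !) 1 (arrangements k) (k !) (m ! * arrangements k) (k !)
           (cong (m ! * arrangements k *_) (sym (*-identityˡ (k !)))) ⟩
  + (m ! * arrangements k) / k !             ∎
  where
  open ≡-Reasoning
  instance k!≢0 = k !≢0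

x*[y*z]+z≡[x*y+1]*z : ∀ x y z → x * (y * z) + z ≡ (x * y + 1) * z
x*[y*z]+z≡[x*y+1]*z = solve-∀

arrangements/!-mono : ∀ {k j} → k ≤ j → arrangements k * j ! ≤ arrangements j * k !
arrangements/!-mono {k} {j} k≤j =
  subst (λ j → arrangements k * j ! ≤ arrangements j * k !) (m∸n+n≡m k≤j) (go (j ∸ k))
  where
  open ≤-Reasoning
  go : ∀ d → arrangements k * (d + k) ! ≤ arrangements (d + k) * k !
  go zero    = ≤-refl
  go (suc d) = let i = d + k in begin
    arrangements k * (suc i * i !)        ≡⟨ x∙yz≈y∙xz (arrangements k) (suc i) (i !) ⟩
    suc i * (arrangements k * i !)        ≤⟨ *-monoʳ-≤ (suc i) (go d) ⟩
    suc i * (arrangements i * k !)        ≤⟨ m≤m+n _ (k !) ⟩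
    suc i * (arrangements i * k !) + k !  ≡⟨ x*[y*z]+z≡[x*y+1]*z (suc i) (arrangements i) (k !) ⟩
    arrangements (suc i) * k !            ∎

-- Cross-multiplied form of  m!·S k + m!/(m·k!) ≤ a(m) + 1/m.  The extra summand m!/(m·k!)
-- dominates the rest of the series, which keeps the induction going once k ≥ m.
arrangements-tail : ∀ {m k} → m ≤ k →
  m * m ! * arrangements k + m ! ≤ (m * arrangements m + 1) * k !
arrangements-tail {m} {k} m≤k =
  subst (λ k → m * m ! * arrangements k + m ! ≤ (m * a + 1) * k !) (m∸n+n≡m m≤k) (go (k ∸ m))
  where
  open ≤-Reasoning
  a = arrangements m
  go : ∀ d → m * m ! * arrangements (d + m) + m ! ≤ (m * a + 1) * (d + m) !
  go zero    = ≤-reflexive (base m (m !) a)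
    where
    base : ∀ m f a → m * f * a + f ≡ (m * a + 1) * f
    base = solve-∀
  go (suc d) = let i = d + m in begin
    m * m ! * (suc i * arrangements i + 1) + m !
      ≡⟨ expand m (m !) i (arrangements i) ⟩
    suc i * (m * m ! * arrangements i) + suc m * m !
      ≤⟨ +-monoʳ-≤ (suc i * (m * m ! * arrangements i)) (*-monoˡ-≤ (m !) (s≤s (m≤n+m m d))) ⟩
    suc i * (m * m ! * arrangements i) + suc i * m !
      ≡⟨ *-distribˡ-+ (suc i) (m * m ! * arrangements i) (m !) ⟨
    suc i * (m * m ! * arrangements i + m !)
      ≤⟨ *-monoʳ-≤ (suc i) (go d) ⟩
    suc i * ((m * a + 1) * i !)
      ≡⟨ x∙yz≈y∙xz (suc i) (m * a + 1) (i !) ⟩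
    (m * a + 1) * (suc i * i !)
      ∎
    where
    expand : ∀ m f i a → m * f * ((1 + i) * a + 1) + f ≡ (1 + i) * (m * f * a) + (1 + m) * f
    expand = solve-∀

-- Cross-multiplied form of  m!·S k ≤ a(m) + 1/m.
efact-bound : ∀ m k → m ! * arrangements k * m ≤ (m * arrangements m + 1) * k !
efact-bound m k with ≤-total k m
... | inj₁ k≤m = begin
  m ! * arrangements k * m          ≡⟨ xy∙z≈z∙yx (m !) (arrangements k) m ⟩
  m * (arrangements k * m !)        ≤⟨ *-monoʳ-≤ m (arrangements/!-mono k≤m) ⟩
  m * (arrangements m * k !)        ≤⟨ m≤m+n _ (k !) ⟩
  m * (arrangements m * k !) + k !  ≡⟨ x*[y*z]+z≡[x*y+1]*z m (arrangements m) (k !) ⟩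
  (m * arrangements m + 1) * k !    ∎
  where open ≤-Reasoning
... | inj₂ m≤k = begin
  m ! * arrangements k * m          ≡⟨ xy∙z≈zx∙y (m !) (arrangements k) m ⟩
  m * m ! * arrangements k          ≤⟨ m≤m+n _ (m !) ⟩
  m * m ! * arrangements k + m !    ≤⟨ arrangements-tail m≤k ⟩
  (m * arrangements m + 1) * k !    ∎
  where open ≤-Reasoning

IsFloorE-intro : ∀ m N k q →
  + N / 1 ≤ℚ efact m k → q <ℚ + suc N / 1 → (∀ j → efact m j ≤ℚ q) → IsFloorE m N
IsFloorE-intro m N k q N≤ q<N+1 bounded =
  (λ p p<N → k , ℚ.<-≤-trans p<N N≤) , q , q<N+1 , bounded

isFloorE-arrangements : ∀ {m} → 2 ≤ m → IsFloorE m (arrangements m)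
isFloorE-arrangements {m} 2≤m = IsFloorE-intro m a m (+ (m * a + 1) / m) lower upper bounded
  where
  instance
    m≢0 : NonZero m
    m≢0 = >-nonZero (≤-trans (s≤s z≤n) 2≤m)
  a = arrangements m
  lower : + a / 1 ≤ℚ efact m m
  lower = ℚ.≤-reflexive (trans
    (/-≡ a 1 (m ! * a) (m !) {{_}} {{m !≢0}} (trans (*-comm a (m !)) (sym (*-identityʳ (m ! * a)))))
    (sym (efact≡m!*arrangements/! m m)))
  upper : + (m * a + 1) / m <ℚ + suc a / 1
  upper = /-< (m * a + 1) m (suc a) 1 (begin-strict
    (m * a + 1) * 1  ≡⟨ *-identityʳ _ ⟩
    m * a + 1        ≡⟨ +-comm (m * a) 1 ⟩
    1 + m * a        <⟨ +-monoˡ-< (m * a) 2≤m ⟩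
    m + m * a        ≡⟨ cong (_+_ m) (*-comm m a) ⟩
    suc a * m        ∎)
    where open ≤-Reasoning
  bounded : ∀ j → efact m j ≤ℚ + (m * a + 1) / m
  bounded j = subst (_≤ℚ + (m * a + 1) / m) (sym (efact≡m!*arrangements/! m j))
    (/-≤ (m ! * arrangements j) (j !) (m * a + 1) m {{j !≢0}} (efact-bound m j))

theorem4 : (n : ℕ) → 2 < n → (u : Fin n) →
    IsFloorE (n ∸ 1) (cycleCount n u + n)
    × IsFloorE n (cycleLengthSum n u + (cycleCount n u + n) + 2 * n ∸ 1)
theorem4 (suc m) (s≤s 2≤m) u =
  subst (IsFloorE m) (sym count) (isFloorE-arrangements 2≤m) ,
  subst (IsFloorE (suc m)) (sym lengthSum) (isFloorE-arrangements (m≤n⇒m≤1+n 2≤m))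
  where
  count : cycleCount (suc m) u + suc m ≡ arrangements m
  count = cycleCount+n≡arrangements m u
  lengthSum : cycleLengthSum (suc m) u + (cycleCount (suc m) u + suc m) + 2 * suc m ∸ 1
              ≡ arrangements (suc m)
  lengthSum = trans (cong (λ c → cycleLengthSum (suc m) u + c + 2 * suc m ∸ 1) count)
                    (cycleLengthSum+arrangements+2n∸1≡arrangements m u)
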